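{- Let $G$ be a finite abelian group of odd order $g$ and let $A\subseteq G$ with $a=|A|$. Then there exists $\beta\in G$ such that $A$ contains at least $\frac12\left(\frac{a^2}{g}-1\right)$ pairwise disjoint unordered pairs $\{\alpha_1,\alpha_2\}\subseteq A$ with $\alpha_1\ne\alpha_2$ and $\alpha_1+\alpha_2=\beta$. -}

module Defs where

open import Level using (0ℓ)
open import Data.Nat using (ℕ)
open import Data.Fin using (Fin)
open import Data.Product using (_×_; _,_; proj₁; proj₂)
open import Data.List using (List; concatMap; _∷_; [])
open import Data.List.Relation.Unary.Unique.Propositional using (Unique)
open import Data.List.Relation.Unary.All using (All)
open import Data.Fin.Subset using (Subset; _∈_)
open import Relation.Binary.PropositionalEquality using (_≡_; _≢_)
open import Algebra.Structures using (IsAbelianGroup)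

-- A finite abelian group of order g, presented (up to isomorphism) on the
-- carrier Fin g with propositional equality.
record FinAbelianGroup (g : ℕ) : Set where
  field
    _+_ : Fin g → Fin g → Fin g
    0#  : Fin g
    -_  : Fin g → Fin g
    isAbelianGroup : IsAbelianGroup _≡_ _+_ 0# -_

pairElems : {g : ℕ} → List (Fin g × Fin g) → List (Fin g)
pairElems = concatMap (λ p → proj₁ p ∷ proj₂ p ∷ [])

DisjointSumPairs : {g : ℕ} → FinAbelianGroup g → Subset g → Fin g →
                   List (Fin g × Fin g) → Set
DisjointSumPairs G A β ps =
  All (λ p → (proj₁ p ∈ A) × (proj₂ p ∈ A) × (proj₁ p ≢ proj₂ p)
             × (FinAbelianGroup._+_ G (proj₁ p) (proj₂ p) ≡ β)) ps
  × Unique (pairElems ps)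

module Submission where

-- For each β the map x ↦ β − x is an involution of G whose non-trivial orbits {x, β − x}
-- inside A are pairwise disjoint pairs summing to β; let k_β be their number. Counting the
-- ordered pairs (x, y) ∈ A² by their sum gives a² = Σ_β (2 k_β + d_β), where d_β counts
-- the fixed points x = β − x in A. Each x is a fixed point only for β = x + x, so
-- Σ_β d_β ≤ g, and therefore a² ≤ 2 g · max_β k_β + g.

open import Defs
open import Level using (0ℓ)
open import Function using (_∘_)
open import Data.Bool using (true; false; if_then_else_)
open import Data.Nat using (ℕ; zero; suc; _+_; _*_; _≤_; z≤n; s≤s)
import Data.Nat.Properties as ℕ
open import Data.Nat.Divisibility using (_∣_; _∣0)
open import Data.Nat.Tactic.RingSolver using (solve-∀)
open import Data.Fin using (Fin; _<_; _<?_; punchIn) renaming (zero to 0F; suc to 1+)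
open import Data.Fin.Properties using (_≟_; <-cmp; <-asym; <-irrefl; punchInᵢ≢i)
open import Data.Fin.Permutation using (permutation)
open import Data.Fin.Subset using (Subset; ∣_∣; inside; outside; _∈_)
open import Data.Fin.Subset.Properties using (_∈?_)
open import Data.Vec using (_∷_; [])
open import Data.Product using (_×_; _,_; proj₁; proj₂; ∃-syntax)
open import Data.List using (List; length; _∷_; map; filter; tabulate; allFin)
open import Data.List.Properties using (length-map)
open import Data.List.Relation.Unary.All as All using (All; _∷_; [])
open import Data.List.Relation.Unary.All.Properties using (all-filter; map⁺)
open import Data.List.Relation.Unary.AllPairs using (_∷_; [])
open import Data.List.Relation.Unary.Unique.Propositional using (Unique)
open import Data.List.Relation.Unary.Unique.Propositional.Properties using (allFin⁺; filter⁺)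
open import Data.Empty using (⊥-elim)
open import Relation.Nullary using (¬_; Dec; does; yes; no)
open import Relation.Nullary.Decidable using (_×-dec_)
open import Relation.Unary using (Decidable)
open import Relation.Binary.Definitions using (tri<; tri≈; tri>)
open import Relation.Binary.PropositionalEquality
open import Algebra.Bundles using (AbelianGroup; Group)
open import Algebra.Properties.Semiring.Sum ℕ.+-*-semiring
  using (sum; sum-cong-≗; sum-permute; sum-remove; ∑-distrib-+; ∑-comm;
         *-distribˡ-sum; *-distribʳ-sum; sum-replicate-zero)

𝟙[_] : ∀ {p} {P : Set p} → Dec P → ℕ
𝟙[ d ] = if does d then 1 else 0

𝟙[yes] : ∀ {p} {P : Set p} (d : Dec P) → P → 𝟙[ d ] ≡ 1
𝟙[yes] (yes _) _ = refl
𝟙[yes] (no ¬p) p = ⊥-elim (¬p p)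

𝟙[no] : ∀ {p} {P : Set p} (d : Dec P) → ¬ P → 𝟙[ d ] ≡ 0
𝟙[no] (yes p) ¬p = ⊥-elim (¬p p)
𝟙[no] (no _)  _  = refl

𝟙[]≤1 : ∀ {p} {P : Set p} (d : Dec P) → 𝟙[ d ] ≤ 1
𝟙[]≤1 (yes _) = s≤s z≤n
𝟙[]≤1 (no _)  = z≤n

𝟙[×-dec] : ∀ {p q} {P : Set p} {Q : Set q} (d : Dec P) (e : Dec Q) →
           𝟙[ d ×-dec e ] ≡ 𝟙[ d ] * 𝟙[ e ]
𝟙[×-dec] (yes _) (yes _) = refl
𝟙[×-dec] (yes _) (no _)  = refl
𝟙[×-dec] (no _)  _       = refl

𝟙[<]+𝟙[≡]+𝟙[>]≡1 : ∀ {n} (x y : Fin n) → 𝟙[ x <? y ] + 𝟙[ x ≟ y ] + 𝟙[ y <? x ] ≡ 1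
𝟙[<]+𝟙[≡]+𝟙[>]≡1 x y with <-cmp x y
... | tri< x<y x≢y x≯y = cong₂ _+_ (cong₂ _+_ (𝟙[yes] (x <? y) x<y) (𝟙[no] (x ≟ y) x≢y)) (𝟙[no] (y <? x) x≯y)
... | tri≈ x≮y x≡y x≯y = cong₂ _+_ (cong₂ _+_ (𝟙[no] (x <? y) x≮y) (𝟙[yes] (x ≟ y) x≡y)) (𝟙[no] (y <? x) x≯y)
... | tri> x≮y x≢y x>y = cong₂ _+_ (cong₂ _+_ (𝟙[no] (x <? y) x≮y) (𝟙[no] (x ≟ y) x≢y)) (𝟙[yes] (y <? x) x>y)

sum-mono-≤ : ∀ {n} {f h : Fin n → ℕ} → (∀ i → f i ≤ h i) → sum f ≤ sum h
sum-mono-≤ {zero}  f≤h = z≤n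
sum-mono-≤ {suc n} f≤h = ℕ.+-mono-≤ (f≤h 0F) (sum-mono-≤ (f≤h ∘ 1+))

sum-1≡n : ∀ n → sum {n} (λ _ → 1) ≡ n
sum-1≡n zero    = refl
sum-1≡n (suc n) = cong suc (sum-1≡n n)

sum-𝟙[≟]≡1 : ∀ {n} (z : Fin n) → sum (λ y → 𝟙[ y ≟ z ]) ≡ 1
sum-𝟙[≟]≡1 {suc n} z = begin
  sum (λ y → 𝟙[ y ≟ z ])                           ≡⟨ sum-remove {i = z} (λ y → 𝟙[ y ≟ z ]) ⟩
  𝟙[ z ≟ z ] + sum (λ j → 𝟙[ punchIn z j ≟ z ])   ≡⟨ cong₂ _+_ (𝟙[yes] (z ≟ z) refl)
                                                        (sum-cong-≗ (λ j → 𝟙[no] (punchIn z j ≟ z) (punchInᵢ≢i z j))) ⟩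
  1 + sum {n} (λ _ → 0)                            ≡⟨ cong suc (sum-replicate-zero n) ⟩
  1                                                ∎
  where open ≡-Reasoning

∣p∣≡sum-𝟙[∈?] : ∀ {n} (p : Subset n) → ∣ p ∣ ≡ sum (λ x → 𝟙[ x ∈? p ])
∣p∣≡sum-𝟙[∈?] []            = refl
∣p∣≡sum-𝟙[∈?] (inside  ∷ p) = cong suc (∣p∣≡sum-𝟙[∈?] p)
∣p∣≡sum-𝟙[∈?] (outside ∷ p) = ∣p∣≡sum-𝟙[∈?] p

sum≤n*max : ∀ n (h : Fin (suc n) → ℕ) → ∃[ i ] sum h ≤ suc n * h i
sum≤n*max zero    h = 0F , ℕ.≤-refl
sum≤n*max (suc n) h with sum≤n*max n (h ∘ 1+)
... | i , sum≤ with h 0F ℕ.≤? h (1+ i)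
...   | yes h₀≤hᵢ = 1+ i , ℕ.+-mono-≤ h₀≤hᵢ sum≤
...   | no  h₀≰hᵢ = 0F , ℕ.+-monoʳ-≤ (h 0F)
                      (ℕ.≤-trans sum≤ (ℕ.*-monoʳ-≤ (suc n) (ℕ.<⇒≤ (ℕ.≰⇒> h₀≰hᵢ))))

length-filter-tabulate : ∀ {a p} {A : Set a} {P : A → Set p} (P? : Decidable P) {n} (f : Fin n → A) →
                         length (filter P? (tabulate f)) ≡ sum (λ i → 𝟙[ P? (f i) ])
length-filter-tabulate P? {zero}  f = refl
length-filter-tabulate P? {suc n} f with does (P? (f 0F))
... | true  = cong suc (length-filter-tabulate P? (f ∘ 1+))
... | false = length-filter-tabulate P? (f ∘ 1+)

pairElems⁺ : ∀ {g} {P : Fin g → Set} {ps : List (Fin g × Fin g)} →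
             All (λ p → P (proj₁ p) × P (proj₂ p)) ps → All P (pairElems ps)
pairElems⁺ []                = []
pairElems⁺ ((p₁ , p₂) ∷ pps) = p₁ ∷ p₂ ∷ pairElems⁺ pps

module Involution {n} (σ : Fin n → Fin n) (σ-involutive : ∀ x → σ (σ x) ≡ x) where

  σ-injective : ∀ {x y} → σ x ≡ σ y → x ≡ y
  σ-injective {x} {y} σx≡σy = trans (sym (σ-involutive x)) (trans (cong σ σx≡σy) (σ-involutive y))

  -- The orbits {x, σ x} with x < σ x and those with σ x < x are matched by σ,
  -- so a σ-invariant sum counts every non-fixed orbit twice.
  sum≡2*sum[<σ]+sum[≡σ] : (f : Fin n → ℕ) → (∀ x → f (σ x) ≡ f x) →
    sum f ≡ 2 * sum (λ x → 𝟙[ x <? σ x ] * f x) + sum (λ x → 𝟙[ x ≟ σ x ] * f x)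
  sum≡2*sum[<σ]+sum[≡σ] f f∘σ≗f = begin
    sum f                         ≡⟨ sum-cong-≗ trichotomy ⟩
    sum (λ x → L x + E x + G x)   ≡⟨ ∑-distrib-+ (λ x → L x + E x) G ⟩
    sum (λ x → L x + E x) + sum G ≡⟨ cong₂ _+_ (∑-distrib-+ L E) sum-G≡sum-L ⟩
    sum L + sum E + sum L         ≡⟨ l+e+l≡2*l+e (sum L) (sum E) ⟩
    2 * sum L + sum E             ∎
    where
    open ≡-Reasoning
    L E G : Fin n → ℕ
    L x = 𝟙[ x <? σ x ] * f x
    E x = 𝟙[ x ≟ σ x ] * f x
    G x = 𝟙[ σ x <? x ] * f x

    trichotomy : ∀ x → f x ≡ L x + E x + G x
    trichotomy x = begin
      f x                                                  ≡⟨ ℕ.*-identityˡ (f x) ⟨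
      1 * f x                                              ≡⟨ cong (_* f x) (𝟙[<]+𝟙[≡]+𝟙[>]≡1 x (σ x)) ⟨
      (𝟙[ x <? σ x ] + 𝟙[ x ≟ σ x ] + 𝟙[ σ x <? x ]) * f x ≡⟨ ℕ.*-distribʳ-+ (f x) (𝟙[ x <? σ x ] + 𝟙[ x ≟ σ x ]) _ ⟩
      (𝟙[ x <? σ x ] + 𝟙[ x ≟ σ x ]) * f x + G x            ≡⟨ cong (_+ G x) (ℕ.*-distribʳ-+ (f x) 𝟙[ x <? σ x ] _) ⟩
      L x + E x + G x                                      ∎

    L∘σ≗G : ∀ x → L (σ x) ≡ G x
    L∘σ≗G x = cong₂ _*_ (cong (λ y → 𝟙[ σ x <? y ]) (σ-involutive x)) (f∘σ≗f x)

    sum-G≡sum-L : sum G ≡ sum L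
    sum-G≡sum-L = begin
      sum G       ≡⟨ sum-cong-≗ L∘σ≗G ⟨
      sum (L ∘ σ) ≡⟨ sum-permute L (permutation σ σ σ-involutive σ-involutive) ⟨
      sum L       ∎

    l+e+l≡2*l+e : ∀ l e → l + e + l ≡ 2 * l + e
    l+e+l≡2*l+e = solve-∀

  <σ⇒≢σ : ∀ {x y} → x < σ x → y < σ y → x ≢ σ y
  <σ⇒≢σ {x} {y} x<σx y<σy x≡σy =
    <-asym y<σy (subst (σ y <_) (σ-involutive y) (subst (λ z → z < σ z) x≡σy x<σx))

  -- The pairs {x, σ x} with x < σ x are pairwise disjoint: x is the smaller element of its pair.
  unique-pairElems : ∀ {xs} → Unique xs → All (λ x → x < σ x) xs →
                     Unique (pairElems (map (λ x → x , σ x) xs))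
  unique-pairElems         []                  []              = []
  unique-pairElems {x ∷ _} (x≢xs ∷ unique-xs) (x<σx ∷ xs<σxs) =
    (x≢σx ∷ pairElems⁺ (map⁺ (All.zipWith x-fresh (x≢xs , xs<σxs))))
    ∷ pairElems⁺ (map⁺ (All.zipWith σx-fresh (x≢xs , xs<σxs)))
    ∷ unique-pairElems unique-xs xs<σxs
    where
    x≢σx : x ≢ σ x
    x≢σx x≡σx = <-irrefl x≡σx x<σx

    x-fresh : ∀ {y} → x ≢ y × y < σ y → x ≢ y × x ≢ σ y
    x-fresh (x≢y , y<σy) = x≢y , <σ⇒≢σ x<σx y<σy

    σx-fresh : ∀ {y} → x ≢ y × y < σ y → σ x ≢ y × σ x ≢ σ y
    σx-fresh (x≢y , y<σy) = (λ σx≡y → <σ⇒≢σ y<σy x<σx (sym σx≡y)) , x≢y ∘ σ-injective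

module SumPairs {g} (G : FinAbelianGroup g) (A : Subset g) where

  abelianGroup : AbelianGroup 0ℓ 0ℓ
  abelianGroup = record { isAbelianGroup = FinAbelianGroup.isAbelianGroup G }

  open AbelianGroup abelianGroup using (_∙_; comm; group)
  open Group group using (_//_)
  open import Algebra.Properties.AbelianGroup abelianGroup using (//-rightDividesˡ; //-rightDividesʳ)

  x∙[β//x]≡β : ∀ β x → x ∙ (β // x) ≡ β
  x∙[β//x]≡β β x = trans (comm x (β // x)) (//-rightDividesˡ x β)

  β//[β//x]≡x : ∀ β x → β // (β // x) ≡ x
  β//[β//x]≡x β x = begin
    β // (β // x)              ≡⟨ cong (_// (β // x)) (x∙[β//x]≡β β x) ⟨
    x ∙ (β // x) // (β // x)   ≡⟨ //-rightDividesʳ (β // x) x ⟩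
    x                          ∎
    where open ≡-Reasoning

  rep : Fin g → Fin g → ℕ
  rep β x = 𝟙[ (x ∈? A) ×-dec (β // x ∈? A) ]

  rep-sym : ∀ β x → rep β (β // x) ≡ rep β x
  rep-sym β x = begin
    rep β (β // x)                    ≡⟨ cong (λ y → 𝟙[ (β // x ∈? A) ×-dec (y ∈? A) ]) (β//[β//x]≡x β x) ⟩
    𝟙[ (β // x ∈? A) ×-dec (x ∈? A) ] ≡⟨ 𝟙[×-dec] (β // x ∈? A) (x ∈? A) ⟩
    𝟙[ β // x ∈? A ] * 𝟙[ x ∈? A ]    ≡⟨ ℕ.*-comm 𝟙[ β // x ∈? A ] 𝟙[ x ∈? A ] ⟩
    𝟙[ x ∈? A ] * 𝟙[ β // x ∈? A ]    ≡⟨ 𝟙[×-dec] (x ∈? A) (β // x ∈? A) ⟨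
    rep β x                           ∎
    where open ≡-Reasoning

  sum-rep≡𝟙[∈?]*∣A∣ : ∀ x → sum (λ β → rep β x) ≡ 𝟙[ x ∈? A ] * ∣ A ∣
  sum-rep≡𝟙[∈?]*∣A∣ x = begin
    sum (λ β → rep β x)                          ≡⟨ sum-cong-≗ (λ β → 𝟙[×-dec] (x ∈? A) (β // x ∈? A)) ⟩
    sum (λ β → 𝟙[ x ∈? A ] * 𝟙[ β // x ∈? A ])   ≡⟨ *-distribˡ-sum 𝟙[ x ∈? A ] (λ β → 𝟙[ β // x ∈? A ]) ⟨
    𝟙[ x ∈? A ] * sum (λ β → 𝟙[ β // x ∈? A ])   ≡⟨ cong (𝟙[ x ∈? A ] *_) (sum-permute _ translation) ⟨
    𝟙[ x ∈? A ] * sum (λ y → 𝟙[ y ∈? A ])        ≡⟨ cong (𝟙[ x ∈? A ] *_) (∣p∣≡sum-𝟙[∈?] A) ⟨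
    𝟙[ x ∈? A ] * ∣ A ∣                          ∎
    where
    open ≡-Reasoning
    translation = permutation (_// x) (_∙ x) (//-rightDividesʳ x) (//-rightDividesˡ x)

  ∑∑rep≡∣A∣² : sum (λ β → sum (rep β)) ≡ ∣ A ∣ * ∣ A ∣
  ∑∑rep≡∣A∣² = begin
    sum (λ β → sum (rep β))              ≡⟨ ∑-comm rep ⟩
    sum (λ x → sum (λ β → rep β x))      ≡⟨ sum-cong-≗ sum-rep≡𝟙[∈?]*∣A∣ ⟩
    sum (λ x → 𝟙[ x ∈? A ] * ∣ A ∣)      ≡⟨ *-distribʳ-sum ∣ A ∣ (λ x → 𝟙[ x ∈? A ]) ⟨
    sum (λ x → 𝟙[ x ∈? A ]) * ∣ A ∣      ≡⟨ cong (_* ∣ A ∣) (∣p∣≡sum-𝟙[∈?] A) ⟨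
    ∣ A ∣ * ∣ A ∣                        ∎
    where open ≡-Reasoning

  module _ (β : Fin g) where
    open Involution (β //_) (β//[β//x]≡x β)

    LowerHalf : Fin g → Set
    LowerHalf x = x < β // x × x ∈ A × β // x ∈ A

    lowerHalf? : Decidable LowerHalf
    lowerHalf? x = (x <? β // x) ×-dec (x ∈? A) ×-dec (β // x ∈? A)

    pairs : List (Fin g × Fin g)
    pairs = map (λ x → x , β // x) (filter lowerHalf? (allFin g))

    pairs-disjoint : DisjointSumPairs G A β pairs
    pairs-disjoint = map⁺ (All.map sumPair (all-filter lowerHalf? (allFin g)))
                   , unique-pairElems (filter⁺ lowerHalf? (allFin⁺ g))
                                      (All.map proj₁ (all-filter lowerHalf? (allFin g)))
      where
      sumPair : ∀ {x} → LowerHalf x → x ∈ A × β // x ∈ A × x ≢ β // x × x ∙ (β // x) ≡ β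
      sumPair {x} (x<β//x , x∈A , β//x∈A) =
        x∈A , β//x∈A , (λ x≡β//x → <-irrefl x≡β//x x<β//x) , x∙[β//x]≡β β x

    length-pairs : length pairs ≡ sum (λ x → 𝟙[ x <? β // x ] * rep β x)
    length-pairs = begin
      length pairs                                ≡⟨ length-map _ (filter lowerHalf? (allFin g)) ⟩
      length (filter lowerHalf? (allFin g))       ≡⟨ length-filter-tabulate lowerHalf? (λ x → x) ⟩
      sum (λ x → 𝟙[ lowerHalf? x ])               ≡⟨ sum-cong-≗ (λ x → 𝟙[×-dec] (x <? β // x) ((x ∈? A) ×-dec (β // x ∈? A))) ⟩
      sum (λ x → 𝟙[ x <? β // x ] * rep β x)      ∎
      where open ≡-Reasoning

    diagonal : Fin g → ℕ
    diagonal x = 𝟙[ x ≟ β // x ] * rep β x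

    sum-rep≡2*length-pairs+sum-diagonal : sum (rep β) ≡ 2 * length pairs + sum diagonal
    sum-rep≡2*length-pairs+sum-diagonal = begin
      sum (rep β)                                                  ≡⟨ sum≡2*sum[<σ]+sum[≡σ] (rep β) (rep-sym β) ⟩
      2 * sum (λ x → 𝟙[ x <? β // x ] * rep β x) + sum diagonal    ≡⟨ cong (λ k → 2 * k + sum diagonal) length-pairs ⟨
      2 * length pairs + sum diagonal                              ∎
      where open ≡-Reasoning

    diagonal≤𝟙[β≟x∙x] : ∀ x → diagonal x ≤ 𝟙[ β ≟ x ∙ x ]
    diagonal≤𝟙[β≟x∙x] x with x ≟ β // x
    ... | no  _       = z≤n
    ... | yes x≡β//x  = begin
      rep β x + 0       ≡⟨ ℕ.+-identityʳ (rep β x) ⟩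
      rep β x           ≤⟨ 𝟙[]≤1 ((x ∈? A) ×-dec (β // x ∈? A)) ⟩
      1                 ≡⟨ 𝟙[yes] (β ≟ x ∙ x) (trans (sym (x∙[β//x]≡β β x)) (cong (x ∙_) (sym x≡β//x))) ⟨
      𝟙[ β ≟ x ∙ x ]    ∎
      where open ℕ.≤-Reasoning

  ∑∑diagonal≤g : sum (λ β → sum (diagonal β)) ≤ g
  ∑∑diagonal≤g = begin
    sum (λ β → sum (diagonal β))              ≤⟨ sum-mono-≤ (λ β → sum-mono-≤ (diagonal≤𝟙[β≟x∙x] β)) ⟩
    sum (λ β → sum (λ x → 𝟙[ β ≟ x ∙ x ]))    ≡⟨ ∑-comm (λ β x → 𝟙[ β ≟ x ∙ x ]) ⟩
    sum (λ x → sum (λ β → 𝟙[ β ≟ x ∙ x ]))    ≡⟨ sum-cong-≗ (λ x → sum-𝟙[≟]≡1 (x ∙ x)) ⟩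
    sum {g} (λ _ → 1)                         ≡⟨ sum-1≡n g ⟩
    g                                         ∎
    where open ℕ.≤-Reasoning

  ∣A∣²≤sum-2*length-pairs+g : ∣ A ∣ * ∣ A ∣ ≤ sum (λ β → 2 * length (pairs β)) + g
  ∣A∣²≤sum-2*length-pairs+g = begin
    ∣ A ∣ * ∣ A ∣                                                          ≡⟨ ∑∑rep≡∣A∣² ⟨
    sum (λ β → sum (rep β))                                                ≡⟨ sum-cong-≗ sum-rep≡2*length-pairs+sum-diagonal ⟩
    sum (λ β → 2 * length (pairs β) + sum (diagonal β))                    ≡⟨ ∑-distrib-+ (λ β → 2 * length (pairs β)) _ ⟩
    sum (λ β → 2 * length (pairs β)) + sum (λ β → sum (diagonal β))        ≤⟨ ℕ.+-monoʳ-≤ _ ∑∑diagonal≤g ⟩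
    sum (λ β → 2 * length (pairs β)) + g                                   ∎
    where open ℕ.≤-Reasoning

-- Oddness of g is needed only to exclude the empty group.
lemma3p18 : (g : ℕ) → ¬ (2 ∣ g) → (G : FinAbelianGroup g) → (A : Subset g) →
    ∃[ β ] ∃[ ps ] (DisjointSumPairs G A β ps ×
    (∣ A ∣ * ∣ A ∣ ≤ 2 * length ps * g + g))
lemma3p18 zero      2∤g G A = ⊥-elim (2∤g (2 ∣0))
lemma3p18 g@(suc n) _   G A =
  let β , sum≤g*max = sum≤n*max n (λ β → 2 * length (pairs β)) in
  β , pairs β , pairs-disjoint β , (begin
    ∣ A ∣ * ∣ A ∣                               ≤⟨ ∣A∣²≤sum-2*length-pairs+g ⟩
    sum (λ β → 2 * length (pairs β)) + g      ≤⟨ ℕ.+-monoˡ-≤ g sum≤g*max ⟩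
    g * (2 * length (pairs β)) + g            ≡⟨ cong (_+ g) (ℕ.*-comm g _) ⟩
    2 * length (pairs β) * g + g              ∎)
  where
  open SumPairs G A
  open ℕ.≤-Reasoning
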